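{- Let $p_1,p_2$ be distinct primes and $a\ge 1$ an integer, and let $n=p_1^{a}p_2$. If $n$ is a strong alpha number of order $(1,1)$, then $n$ is a perfect number, i.e. $\sigma(n)=2n$.
   Context: For a positive integer $n$, $\sigma(n)=\sum_{d\mid n} d$ and $\omega(n)$ is the number of distinct prime divisors of $n$. A positive integer $n$ is a strong alpha number of order $(1,1)$ if there exist coprime positive integers $\alpha_1,\alpha_2$ with $\sigma(n)=\frac{\alpha_1}{\alpha_2}n$ and $2\le \max(\alpha_1,\alpha_2)\le \omega(n)$. -}

module Defs where

open import Data.Nat using (ℕ; suc; _+_; _*_; _⊔_)
open import Data.Nat.Divisibility using (_∣_; _∣?_)
open import Data.Nat.Primality using (Prime; prime?)
open import Data.List using (List; filter; length; upTo; map)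
open import Data.Nat.ListAction using (sum)
open import Relation.Nullary.Decidable using (_×-dec_)

range1 : ℕ → List ℕ
range1 n = map suc (upTo n)

-- σ(n) = sum of the positive divisors of n (σ(0) = 0; only used for n ≥ 1)
σ : ℕ → ℕ
σ n = sum (filter (λ d → d ∣? n) (range1 n))

-- ω(n) = number of distinct primes dividing n (primes dividing n lie in 1..n for n ≥ 1)
ω : ℕ → ℕ
ω n = length (filter (λ p → prime? p ×-dec (p ∣? n)) (range1 n))

{-# OPTIONS --safe #-}
module Submission where

-- Since ω(p₁^a p₂) ≤ 2, the hypothesis forces max(α₁, α₂) = 2, and coprimality
-- then leaves only α₁/α₂ ∈ {2/1, 1/2}. The ratio σ(n)/n = 1/2 is impossible
-- because n itself divides n, so σ(n) ≥ n; hence σ(n) = 2n.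

open import Defs
open import Data.Nat using (ℕ; zero; suc; _*_; _^_; _≤_; _⊔_; z≤n; s≤s; NonZero)
open import Data.Nat.Base using (nonTrivial⇒≢1)
open import Data.Nat.Properties
open import Data.Nat.Divisibility using (_∣_; _∣?_; ∣-refl; _∣0; ∣1⇒≡1)
open import Data.Nat.Primality using (Prime; prime?; euclidsLemma; prime⇒irreducible; prime⇒nonTrivial; prime⇒nonZero)
open import Data.Nat.Coprimality using (Coprime)
open import Data.Nat.ListAction using (sum)
open import Data.List using (List; []; _∷_; filter; length)
open import Data.List.Membership.Propositional using (_∈_)
open import Data.List.Membership.Propositional.Properties using (∈-upTo⁺; ∈-map⁺; ∈-filter⁺)
open import Data.List.Relation.Unary.Any using (here; there)
open import Data.List.Relation.Unary.All as All using (All; _∷_)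
open import Data.List.Relation.Unary.All.Properties using (all-filter)
open import Data.List.Relation.Unary.AllPairs using (_∷_)
open import Data.List.Relation.Unary.Unique.Propositional using (Unique)
import Data.List.Relation.Unary.Unique.Propositional.Properties as Unique
open import Data.Product using (_×_; _,_)
open import Data.Sum using (_⊎_; inj₁; inj₂)
open import Relation.Nullary using (¬_; contradiction)
open import Relation.Nullary.Decidable using (_×-dec_)
open import Relation.Binary.PropositionalEquality using (_≡_; _≢_; refl; sym; trans)

∈⇒≤sum : ∀ {x xs} → x ∈ xs → x ≤ sum xs
∈⇒≤sum {xs = y ∷ ys} (here refl) = m≤m+n y (sum ys)
∈⇒≤sum {xs = y ∷ ys} (there x∈ys) = ≤-trans (∈⇒≤sum x∈ys) (m≤n+m (sum ys) y)

n≤σ[n] : ∀ n → .{{NonZero n}} → n ≤ σ n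
n≤σ[n] (suc k) = ∈⇒≤sum (∈-filter⁺ (_∣? suc k) (∈-map⁺ suc (∈-upTo⁺ ≤-refl)) ∣-refl)

2*σ[n]≢n : ∀ n → .{{NonZero n}} → 2 * σ n ≢ n
2*σ[n]≢n n 2σ≡n = <-irrefl refl (begin-strict
  n        <⟨ m<m*n n 2 (s≤s (s≤s z≤n)) ⟩
  n * 2    ≡⟨ *-comm n 2 ⟩
  2 * n    ≤⟨ *-monoʳ-≤ 2 (n≤σ[n] n) ⟩
  2 * σ n  ≡⟨ 2σ≡n ⟩
  n        ∎)
  where open ≤-Reasoning

prime∣prime⇒≡ : ∀ {q p} → Prime q → Prime p → q ∣ p → q ≡ p
prime∣prime⇒≡ q-prime p-prime q∣p with prime⇒irreducible p-prime q∣p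
... | inj₁ q≡1 = contradiction q≡1 (nonTrivial⇒≢1 {{prime⇒nonTrivial q-prime}})
... | inj₂ q≡p = q≡p

prime∣p^a⇒≡p : ∀ {q p} a → Prime q → Prime p → q ∣ p ^ a → q ≡ p
prime∣p^a⇒≡p zero q-prime _ q∣1 =
  contradiction (∣1⇒≡1 q∣1) (nonTrivial⇒≢1 {{prime⇒nonTrivial q-prime}})
prime∣p^a⇒≡p {p = p} (suc a) q-prime p-prime q∣p^[1+a]
  with euclidsLemma p (p ^ a) q-prime q∣p^[1+a]
... | inj₁ q∣p   = prime∣prime⇒≡ q-prime p-prime q∣p
... | inj₂ q∣p^a = prime∣p^a⇒≡p a q-prime p-prime q∣p^a

prime∣p^a*r⇒≡p⊎≡r : ∀ {q p r} a → Prime q → Prime p → Prime r →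
                     q ∣ p ^ a * r → q ≡ p ⊎ q ≡ r
prime∣p^a*r⇒≡p⊎≡r {p = p} {r} a q-prime p-prime r-prime q∣p^a*r
  with euclidsLemma (p ^ a) r q-prime q∣p^a*r
... | inj₁ q∣p^a = inj₁ (prime∣p^a⇒≡p a q-prime p-prime q∣p^a)
... | inj₂ q∣r   = inj₂ (prime∣prime⇒≡ q-prime r-prime q∣r)

unique∧⊆[p,q]⇒length≤2 : ∀ {p q} (xs : List ℕ) → Unique xs →
                          All (λ x → x ≡ p ⊎ x ≡ q) xs → length xs ≤ 2
unique∧⊆[p,q]⇒length≤2 []              _ _ = z≤n
unique∧⊆[p,q]⇒length≤2 (_ ∷ [])        _ _ = s≤s z≤n
unique∧⊆[p,q]⇒length≤2 (_ ∷ _ ∷ [])    _ _ = s≤s (s≤s z≤n)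
unique∧⊆[p,q]⇒length≤2 (x ∷ y ∷ z ∷ _) ((x≢y ∷ x≢z ∷ _) ∷ (y≢z ∷ _) ∷ _) (x∈ ∷ y∈ ∷ z∈ ∷ _) =
  contradiction (x∈ , y∈ , z∈) pigeonhole
  where
  pigeonhole : ¬ ((x ≡ _ ⊎ x ≡ _) × (y ≡ _ ⊎ y ≡ _) × (z ≡ _ ⊎ z ≡ _))
  pigeonhole (inj₁ x≡p , inj₁ y≡p , _)      = x≢y (trans x≡p (sym y≡p))
  pigeonhole (inj₂ x≡q , inj₂ y≡q , _)      = x≢y (trans x≡q (sym y≡q))
  pigeonhole (inj₁ x≡p , inj₂ _ , inj₁ z≡p) = x≢z (trans x≡p (sym z≡p))
  pigeonhole (inj₂ x≡q , inj₁ _ , inj₂ z≡q) = x≢z (trans x≡q (sym z≡q))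
  pigeonhole (inj₁ _ , inj₂ y≡q , inj₂ z≡q) = y≢z (trans y≡q (sym z≡q))
  pigeonhole (inj₂ _ , inj₁ y≡p , inj₁ z≡p) = y≢z (trans y≡p (sym z≡p))

ω[p^a*q]≤2 : ∀ {p q} a → Prime p → Prime q → ω (p ^ a * q) ≤ 2
ω[p^a*q]≤2 {p} {q} a p-prime q-prime =
  unique∧⊆[p,q]⇒length≤2 _
    (Unique.filter⁺ prime∣n? (Unique.map⁺ suc-injective (Unique.upTo⁺ n)))
    (All.map primeDivisor≡p⊎≡q (all-filter prime∣n? (range1 n)))
  where
  n = p ^ a * q
  prime∣n? = λ r → prime? r ×-dec (r ∣? n)
  primeDivisor≡p⊎≡q : ∀ {r} → Prime r × r ∣ n → r ≡ p ⊎ r ≡ q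
  primeDivisor≡p⊎≡q (r-prime , r∣n) = prime∣p^a*r⇒≡p⊎≡r a r-prime p-prime q-prime r∣n

coprime∧⊔≡2⇒[2,1]⊎[1,2] : ∀ {x y} → Coprime x y → x ⊔ y ≡ 2 →
                           (x ≡ 2 × y ≡ 1) ⊎ (x ≡ 1 × y ≡ 2)
coprime∧⊔≡2⇒[2,1]⊎[1,2] {x} {y} coprime x⊔y≡2 =
  cases x y (≤-trans (m≤m⊔n x y) (≤-reflexive x⊔y≡2))
            (≤-trans (m≤n⊔m x y) (≤-reflexive x⊔y≡2)) coprime x⊔y≡2
  where
  cases : ∀ x y → x ≤ 2 → y ≤ 2 → Coprime x y → x ⊔ y ≡ 2 →
          (x ≡ 2 × y ≡ 1) ⊎ (x ≡ 1 × y ≡ 2)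
  cases 2 1 _ _ _ _ = inj₁ (refl , refl)
  cases 1 2 _ _ _ _ = inj₂ (refl , refl)
  cases 0 2 _ _ c _ = contradiction (c (2 ∣0 , ∣-refl)) λ ()
  cases 2 0 _ _ c _ = contradiction (c (∣-refl , 2 ∣0)) λ ()
  cases 2 2 _ _ c _ = contradiction (c (∣-refl , ∣-refl)) λ ()
  cases 0 0 _ _ _ ()
  cases 0 1 _ _ _ ()
  cases 1 0 _ _ _ ()
  cases 1 1 _ _ _ ()
  cases (suc (suc (suc _))) _ (s≤s (s≤s ())) _ _ _
  cases _ (suc (suc (suc _))) _ (s≤s (s≤s ())) _ _

theorem3p5 : (p₁ p₂ a : ℕ) → Prime p₁ → Prime p₂ → ¬ (p₁ ≡ p₂) → 1 ≤ a →
    (α₁ α₂ : ℕ) → 1 ≤ α₁ → 1 ≤ α₂ → Coprime α₁ α₂ →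
    α₂ * σ (p₁ ^ a * p₂) ≡ α₁ * (p₁ ^ a * p₂) →
    2 ≤ α₁ ⊔ α₂ → α₁ ⊔ α₂ ≤ ω (p₁ ^ a * p₂) →
    σ (p₁ ^ a * p₂) ≡ 2 * (p₁ ^ a * p₂)
theorem3p5 p₁ p₂ a p₁-prime p₂-prime _ _ α₁ α₂ _ _ coprime σ-ratio 2≤α₁⊔α₂ α₁⊔α₂≤ω
  with coprime∧⊔≡2⇒[2,1]⊎[1,2] coprime
         (≤-antisym (≤-trans α₁⊔α₂≤ω (ω[p^a*q]≤2 a p₁-prime p₂-prime)) 2≤α₁⊔α₂)
... | inj₁ (refl , refl) = trans (sym (*-identityˡ _)) σ-ratio
... | inj₂ (refl , refl) = contradiction (trans σ-ratio (*-identityˡ _)) (2*σ[n]≢n _)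
  where
  instance
    n≢0 : NonZero (p₁ ^ a * p₂)
    n≢0 = m*n≢0 (p₁ ^ a) p₂ {{m^n≢0 p₁ a {{prime⇒nonZero p₁-prime}}}} {{prime⇒nonZero p₂-prime}}
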